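{- Let $G=(V,E)$ be a bridgeless cubic graph and let $V=A\cup B$ be a flow partition of $G$ with respect to a 2-factor $\mathcal{F}_2$, obtained from a canonical 4-coloring $c$ of $G$ (as described in the context). Let $e=xy\in E$. If $c$ colors $e$ with $1$ or $2$, then $x$ and $y$ belong to different classes, i.e. $x\in A$ if and only if $y\in B$.
   Context: Graphs may have multiple edges but no loops. A flow on a graph $M$ is a pair $(D,\varphi)$ where $D$ is an orientation and $\varphi$ a nonnegative integer function on edges with inflow equal to outflow at each vertex. For flows $(D_1,\varphi_1)$ on $M[E_1]$ and $(D_2,\varphi_2)$ on $M[E_2]$ (extended by $0$ outside their edge sets), the sum is the flow $(D,\varphi)$ on $M[E_1\cup E_2]$ where $D$ agrees with $D_1$ on edges with $\varphi_1(e)\ge\varphi_2(e)$ and with $D_2$ on edges with $\varphi_2(e)>\varphi_1(e)$, and $\varphi(e)=\varphi_1(e)+\varphi_2(e)$ if $e$ has the same direction in $D_1$ and $D_2$, and $\varphi(e)=|\varphi_1(e)-\varphi_2(e)|$ otherwise; sums of several flows are formed iteratively. Flow partition: Let $G=(V,E)$ be a bridgeless cubic graph and $\mathcal{F}_2$ a 2-factor of $G$ with odd cycles $C_1,\dots,C_{2t}$ and even cycles $C_{2t+1},\dots,C_{2t+\ell}$ ($t,\ell\ge 0$). A canonical 4-coloring $c$ (w.r.t. $\mathcal{F}_2$) colors the edges of the complementary 1-factor with $1$, the edges of each even cycle alternately with $2$ and $3$, and the edges of each odd cycle alternately with $2$ and $3$ except for exactly one edge colored $0$. Then there are exactly $2t$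 vertices $z_1,\dots,z_{2t}$ at which color $2$ is missing. Let $M_G$ be obtained from $G$ by adding two edges $f_i,f_i'$ between $z_{2i-1}$ and $z_{2i}$ for $i=1,\dots,t$; extend $c$ by coloring $f_i'$ with $2$ and $f_i$ with $4$. Let $C_1',\dots,C_s'$ be the cycles of the 2-factor of $M_G$ formed by edges colored $1$ and $2$, and $C_i''$ the 2-cycle formed by $f_i,f_i'$. Let $(D_i,\varphi_i)$ be a flow on $C_i$ ($1\le i\le 2t+\ell$) directing it as a directed cycle with value $2$ on each edge; $(D_i',\varphi_i')$ a flow on $C_i'$ directing it as a directed cycle with value $1$ on each edge; $(D_i'',\varphi_i'')$ a flow on $C_i''$ directing it as a directed cycle with value $1$ on $f_i,f_i'$, where $f_i'$ receives the same direction as in the flow on the cycle $C_j'$ containing it. Let $(D,\varphi)$ be the sum of all these flows; it is a nowhere-zero 4-flow on $M_G$. Define $w'(v)=2(2d^+_{D}(v)-d_{M_G}(v))$, where $d^+_D(v)$ is the outdegree of $v$ in $D$ and $d_{M_G}(v)$ is the degree of $v$ in $M_G$; by the construction $w'(v)\in\{\pm 2\}$ for all $v$. Set $A=\{v: w'(v)=-2\}$ (white vertices) and $B=\{v:w'(v)=2\}$ (black vertices). Any partition $V=A\cup B$ arising this way (for some choice of $\mathcal{F}_2$, $c$ and the cycle orientations) is called a flow partition of $G$ with respect to $\mathcal{F}_2$. -}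

module Defs where

open import Data.Nat using (ℕ; zero; suc; _+_; _*_; _≤ᵇ_; ∣_-_∣; _%_; _≡ᵇ_)
open import Data.Fin using (Fin)
open import Data.Fin.Properties using (_≟_)
open import Data.Bool using (Bool; true; false; if_then_else_; _∧_; _∨_; not)
open import Data.List using (List; []; _∷_; map; _++_; allFin)
open import Data.Product using (_×_; _,_; proj₁; proj₂; ∃-syntax)
open import Data.Sum using (_⊎_)
open import Data.Integer as ℤ using (ℤ; +_; -_)
open import Relation.Nullary using (¬_)
open import Relation.Nullary.Decidable using (⌊_⌋)
open import Relation.Binary.PropositionalEquality using (_≡_; _≢_)
open import Function.Bundles using (_⇔_)

eqF : ∀ {n} → Fin n → Fin n → Bool
eqF u v = ⌊ u ≟ v ⌋

count : ∀ {X : Set} → (X → Bool) → List X → ℕ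
count p [] = 0
count p (x ∷ xs) = (if p x then 1 else 0) + count p xs

sumL : ∀ {X : Set} → (X → ℕ) → List X → ℕ
sumL f [] = 0
sumL f (x ∷ xs) = f x + sumL f xs

-- Multigraphs: vertices Fin n, edges of some type X listed by a list,
-- each edge has an (ordered, for reference) pair of end vertices.

incB : ∀ {n} {X : Set} → (X → Fin n × Fin n) → X → Fin n → Bool
incB ends e v = eqF (proj₁ (ends e)) v ∨ eqF (proj₂ (ends e)) v

Loopless : ∀ {n m} → (Fin m → Fin n × Fin n) → Set
Loopless ends = ∀ e → proj₁ (ends e) ≢ proj₂ (ends e)

deg : ∀ {n m} → (Fin m → Fin n × Fin n) → Fin n → ℕ
deg {m = m} ends v = count (λ e → incB ends e v) (allFin m)

Cubic : ∀ {n m} → (Fin m → Fin n × Fin n) → Set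
Cubic ends = ∀ v → deg ends v ≡ 3

data Reach {n} {X : Set} (ends : X → Fin n × Fin n) (ok : X → Set) (u : Fin n)
     : Fin n → Set where
  here : Reach ends ok u u
  fwd  : ∀ {w} e → Reach ends ok u w → ok e → proj₁ (ends e) ≡ w →
         Reach ends ok u (proj₂ (ends e))
  bwd  : ∀ {w} e → Reach ends ok u w → ok e → proj₂ (ends e) ≡ w →
         Reach ends ok u (proj₁ (ends e))

Bridgeless : ∀ {n m} → (Fin m → Fin n × Fin n) → Set
Bridgeless ends = ∀ e → Reach ends (λ e' → e' ≢ e) (proj₁ (ends e)) (proj₂ (ends e))

TwoFactor : ∀ {n m} → (Fin m → Fin n × Fin n) → (Fin m → Bool) → Set
TwoFactor {m = m} ends F = ∀ v → count (λ e → F e ∧ incB ends e v) (allFin m) ≡ 2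

CycleLabelling : ∀ {n m k} → (Fin m → Fin n × Fin n) → (Fin m → Bool) →
                 (Fin n → Fin k) → Set
CycleLabelling ends F cyc =
  ∀ u v → (cyc u ≡ cyc v) ⇔ Reach ends (λ e → F e ≡ true) u v

cycEdges : ∀ {n m k} → (Fin m → Fin n × Fin n) → (Fin m → Bool) →
           (Fin n → Fin k) → Fin k → ℕ
cycEdges {m = m} ends F cyc j =
  count (λ e → F e ∧ eqF (cyc (proj₁ (ends e))) j) (allFin m)

cycZeros : ∀ {n m k} → (Fin m → Fin n × Fin n) → (Fin m → Bool) →
           (Fin n → Fin k) → (Fin m → ℕ) → Fin k → ℕ
cycZeros {m = m} ends F cyc c j =
  count (λ e → F e ∧ eqF (cyc (proj₁ (ends e))) j ∧ (c e ≡ᵇ 0)) (allFin m)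

-- canonical 4-colouring (colours 0,1,2,3) w.r.t. the 2-factor F:
-- complementary 1-factor coloured 1; each cycle of F coloured with 0,2,3
-- so that consecutive edges differ ("alternately", i.e. properly),
-- with exactly one edge coloured 0 on odd cycles and none on even cycles.
record Canonical {n m k} (ends : Fin m → Fin n × Fin n) (F : Fin m → Bool)
                 (cyc : Fin n → Fin k) (c : Fin m → ℕ) : Set where
  field
    offF   : ∀ e → F e ≡ false → c e ≡ 1
    onF    : ∀ e → F e ≡ true → c e ≡ 0 ⊎ c e ≡ 2 ⊎ c e ≡ 3
    proper : ∀ e e' v → e ≢ e' → incB ends e v ≡ true → incB ends e' v ≡ true →
             c e ≢ c e'
    zeros  : ∀ j → cycZeros ends F cyc c j ≡ cycEdges ends F cyc j % 2

Missing2 : ∀ {n m} → (Fin m → Fin n × Fin n) → (Fin m → ℕ) → Fin n → Set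
Missing2 ends c v = ∀ e → incB ends e v ≡ true → c e ≢ 2

-- z enumerates the vertices missing colour 2 without repetition, grouped
-- in pairs (z i false , z i true)  (= z_{2i-1}, z_{2i})
record MissingPairing {n m t} (ends : Fin m → Fin n × Fin n) (c : Fin m → ℕ)
                      (z : Fin t → Bool → Fin n) : Set where
  field
    inj      : ∀ i a j b → z i a ≡ z j b → i ≡ j × a ≡ b
    sound    : ∀ i a → Missing2 ends c (z i a)
    complete : ∀ v → Missing2 ends c v → ∃[ i ] ∃[ a ] z i a ≡ v

data MEdge (m t : ℕ) : Set where
  old : Fin m → MEdge m t
  fe  : Fin t → MEdge m t
  fe' : Fin t → MEdge m t

allMEdges : ∀ m t → List (MEdge m t)
allMEdges m t = map old (allFin m) ++ (map fe (allFin t) ++ map fe' (allFin t))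

mEnds : ∀ {n m t} → (Fin m → Fin n × Fin n) → (Fin t → Bool → Fin n) →
        MEdge m t → Fin n × Fin n
mEnds ends z (old e) = ends e
mEnds ends z (fe i)  = z i false , z i true
mEnds ends z (fe' i) = z i false , z i true

mColour : ∀ {m t} → (Fin m → ℕ) → MEdge m t → ℕ
mColour c (old e) = c e
mColour c (fe i)  = 4
mColour c (fe' i) = 2

-- Flows: an orientation (dir e = true : from proj₁ to proj₂ of the ends)
-- and a nonnegative integer value on each edge.

record Flow (X : Set) : Set where
  constructor mkFlow
  field
    dir : X → Bool
    val : X → ℕ
open Flow public

tailV : ∀ {n} {X : Set} → (X → Fin n × Fin n) → (X → Bool) → X → Fin n
tailV ends D e = if D e then proj₁ (ends e) else proj₂ (ends e)

headV : ∀ {n} {X : Set} → (X → Fin n × Fin n) → (X → Bool) → X → Fin n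
headV ends D e = if D e then proj₂ (ends e) else proj₁ (ends e)

inflow : ∀ {n} {X : Set} → List X → (X → Fin n × Fin n) → Flow X → Fin n → ℕ
inflow es ends Φ v = sumL (λ e → if eqF (headV ends (dir Φ) e) v then val Φ e else 0) es

outflow : ∀ {n} {X : Set} → List X → (X → Fin n × Fin n) → Flow X → Fin n → ℕ
outflow es ends Φ v = sumL (λ e → if eqF (tailV ends (dir Φ) e) v then val Φ e else 0) es

IsFlow : ∀ {n} {X : Set} → List X → (X → Fin n × Fin n) → Flow X → Set
IsFlow es ends Φ = ∀ v → inflow es ends Φ v ≡ outflow es ends Φ v

sameB : Bool → Bool → Bool
sameB a b = if a then b else not b

_⊕_ : ∀ {X : Set} → Flow X → Flow X → Flow X
Φ₁ ⊕ Φ₂ = mkFlow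
  (λ e → if val Φ₂ e ≤ᵇ val Φ₁ e then dir Φ₁ e else dir Φ₂ e)
  (λ e → if sameB (dir Φ₁ e) (dir Φ₂ e) then val Φ₁ e + val Φ₂ e
         else ∣ val Φ₁ e - val Φ₂ e ∣)

-- The three families of flows on M_G (each family is a union of
-- edge-disjoint cycle flows, so its iterated sum is a single flow).

-- sum of the flows on C_1..C_{2t+l}: value 2 on edges of F, each cycle
-- directed (conservation), 0 elsewhere
FlowF : ∀ {n m t} → (Fin m → Fin n × Fin n) → (Fin t → Bool → Fin n) →
        (Fin m → Bool) → Flow (MEdge m t) → Set
FlowF {m = m} {t = t} ends z F Φ =
  IsFlow (allMEdges m t) (mEnds ends z) Φ ×
  (∀ e → val Φ (old e) ≡ (if F e then 2 else 0)) ×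
  (∀ i → val Φ (fe i) ≡ 0) × (∀ i → val Φ (fe' i) ≡ 0)

-- sum of the flows on C'_1..C'_s (cycles of colours 1 and 2 in M_G):
-- value 1 on edges coloured 1 or 2, directed cycles, 0 elsewhere
Flow12 : ∀ {n m t} → (Fin m → Fin n × Fin n) → (Fin t → Bool → Fin n) →
         (Fin m → ℕ) → Flow (MEdge m t) → Set
Flow12 {m = m} {t = t} ends z c Φ =
  IsFlow (allMEdges m t) (mEnds ends z) Φ ×
  (∀ x → val Φ x ≡ (if (mColour c x ≡ᵇ 1) ∨ (mColour c x ≡ᵇ 2) then 1 else 0))

-- sum of the flows on C''_i = {f_i, f_i'}: value 1 on f_i, f_i', directed
-- 2-cycles, f_i' directed as in the flow Φ12 on C'_j
Flow2cyc : ∀ {n m t} → (Fin m → Fin n × Fin n) → (Fin t → Bool → Fin n) →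
           Flow (MEdge m t) → Flow (MEdge m t) → Set
Flow2cyc {m = m} {t = t} ends z Φ12 Φ =
  IsFlow (allMEdges m t) (mEnds ends z) Φ ×
  (∀ e → val Φ (old e) ≡ 0) ×
  (∀ i → val Φ (fe i) ≡ 1) × (∀ i → val Φ (fe' i) ≡ 1) ×
  (∀ i → dir Φ (fe' i) ≡ dir Φ12 (fe' i))

outdegM : ∀ {n m t} → (Fin m → Fin n × Fin n) → (Fin t → Bool → Fin n) →
          (MEdge m t → Bool) → Fin n → ℕ
outdegM {m = m} {t = t} ends z D v =
  count (λ x → eqF (tailV (mEnds ends z) D x) v) (allMEdges m t)

degM : ∀ {n m t} → (Fin m → Fin n × Fin n) → (Fin t → Bool → Fin n) → Fin n → ℕ
degM {m = m} {t = t} ends z v = count (λ x → incB (mEnds ends z) x v) (allMEdges m t)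

w' : ∀ {n m t} → (Fin m → Fin n × Fin n) → (Fin t → Bool → Fin n) →
     (MEdge m t → Bool) → Fin n → ℤ
w' ends z D v = + 2 ℤ.* (+ (2 * outdegM ends z D v) ℤ.- + degM ends z v)

InA : ∀ {n m t} → (Fin m → Fin n × Fin n) → (Fin t → Bool → Fin n) →
      (MEdge m t → Bool) → Fin n → Set
InA ends z D v = w' ends z D v ≡ - (+ 2)

InB : ∀ {n m t} → (Fin m → Fin n × Fin n) → (Fin t → Bool → Fin n) →
      (MEdge m t → Bool) → Fin n → Set
InB ends z D v = w' ends z D v ≡ + 2

-- Half of w'(v) is the net outdegree of D at v, i.e. the sum over the edges
-- at v of their signed incidences (+1 at the tail, -1 at the head). On every
-- edge D is the direction of the summand carrying the largest value, so this
-- sum splits into the net outflow of the flows on the cycles of F₂ (halved),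
-- the net outflow of the flows on the 2-cycles C''_i, and the net outflow of
-- the colour-1 edges in the flow on the cycles C'_j. The first two vanish by
-- conservation, and conservation of the (1,2)-flow turns the third into
-- minus the net outflow of its colour-2 edges. At an end v of an edge e of
-- colour 1 or 2, e is the only edge of M_G at v with that colour, so half of
-- w'(v) is ± the signed incidence of e at v, which changes sign between the
-- two ends of e.
module Submission where

open import Defs
open import Data.Nat as ℕ using (ℕ; zero; suc; _≡ᵇ_; z≤n; s≤s)
open import Data.Nat.Properties as ℕ using ()
open import Data.Fin using (Fin; zero; suc)
open import Data.Fin.Properties using (_≟_; suc-injective)
open import Data.Bool using (Bool; true; false; if_then_else_; _∨_; T)
open import Data.Bool.Properties using (∨-comm)
open import Data.Unit using (tt)
open import Data.Empty using (⊥; ⊥-elim)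
open import Data.Product using (_×_; _,_; proj₁; proj₂)
open import Data.Sum using (_⊎_; inj₁; inj₂)
open import Data.List using (List; []; _∷_; map; _++_; allFin; tabulate)
open import Data.Integer using (ℤ; +_; -_; _+_; _-_; _*_)
open import Data.Integer.Properties as ℤ using ()
open import Data.Integer.Tactic.RingSolver using (solve-∀)
open import Algebra.Properties.AbelianGroup ℤ.+-0-abelianGroup using (inverseˡ-unique)
open import Relation.Nullary using (yes; no)
open import Relation.Binary.PropositionalEquality
  using (_≡_; _≢_; refl; sym; trans; cong; cong₂; subst; module ≡-Reasoning)
open import Function.Bundles using (_⇔_; mk⇔)

private variable
  X Y : Set
  n : ℕ

χ : Bool → ℤ
χ b = + (if b then 1 else 0)

χ-≡ᵇ-refl : ∀ j → χ (j ≡ᵇ j) ≡ + 1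
χ-≡ᵇ-refl zero = refl
χ-≡ᵇ-refl (suc j) = χ-≡ᵇ-refl j

sumℤ : (X → ℤ) → List X → ℤ
sumℤ f [] = + 0
sumℤ f (x ∷ xs) = f x + sumℤ f xs

sumℤ-cong : ∀ {f g : X → ℤ} xs → (∀ x → f x ≡ g x) → sumℤ f xs ≡ sumℤ g xs
sumℤ-cong [] f≗g = refl
sumℤ-cong (x ∷ xs) f≗g = cong₂ _+_ (f≗g x) (sumℤ-cong xs f≗g)

sumℤ-+ : ∀ (f g : X → ℤ) xs → sumℤ (λ x → f x + g x) xs ≡ sumℤ f xs + sumℤ g xs
sumℤ-+ f g [] = refl
sumℤ-+ f g (x ∷ xs) =
  trans (cong (_+_ (f x + g x)) (sumℤ-+ f g xs)) (interchange (f x) (g x) (sumℤ f xs) (sumℤ g xs))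
  where
  interchange : ∀ a b c d → a + b + (c + d) ≡ a + c + (b + d)
  interchange = solve-∀

sumℤ-- : ∀ (f g : X → ℤ) xs → sumℤ (λ x → f x - g x) xs ≡ sumℤ f xs - sumℤ g xs
sumℤ-- f g [] = refl
sumℤ-- f g (x ∷ xs) =
  trans (cong (_+_ (f x - g x)) (sumℤ-- f g xs)) (interchange (f x) (g x) (sumℤ f xs) (sumℤ g xs))
  where
  interchange : ∀ a b c d → a - b + (c - d) ≡ a + c - (b + d)
  interchange = solve-∀

sumℤ-*ˡ : ∀ k (f : X → ℤ) xs → sumℤ (λ x → k * f x) xs ≡ k * sumℤ f xs
sumℤ-*ˡ k f [] = sym (ℤ.*-zeroʳ k)
sumℤ-*ˡ k f (x ∷ xs) =
  trans (cong (_+_ (k * f x)) (sumℤ-*ˡ k f xs)) (sym (ℤ.*-distribˡ-+ k (f x) (sumℤ f xs)))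

sumℤ-++ : ∀ (f : X → ℤ) xs ys → sumℤ f (xs ++ ys) ≡ sumℤ f xs + sumℤ f ys
sumℤ-++ f [] ys = sym (ℤ.+-identityˡ (sumℤ f ys))
sumℤ-++ f (x ∷ xs) ys =
  trans (cong (_+_ (f x)) (sumℤ-++ f xs ys)) (sym (ℤ.+-assoc (f x) (sumℤ f xs) (sumℤ f ys)))

sumℤ-map : ∀ (f : Y → ℤ) (g : X → Y) xs → sumℤ f (map g xs) ≡ sumℤ (λ x → f (g x)) xs
sumℤ-map f g [] = refl
sumℤ-map f g (x ∷ xs) = cong (_+_ (f (g x))) (sumℤ-map f g xs)

sumℤ-tabulate-zero : ∀ {m} (f : X → ℤ) (g : Fin m → X) →
                     (∀ i → f (g i) ≡ + 0) → sumℤ f (tabulate g) ≡ + 0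
sumℤ-tabulate-zero {m = zero} f g f∘g≡0 = refl
sumℤ-tabulate-zero {m = suc m} f g f∘g≡0 =
  cong₂ _+_ (f∘g≡0 zero) (sumℤ-tabulate-zero f (λ i → g (suc i)) (λ i → f∘g≡0 (suc i)))

sumℤ-tabulate-single : ∀ {m} (f : X → ℤ) (g : Fin m → X) (j : Fin m) →
                       (∀ i → i ≢ j → f (g i) ≡ + 0) → sumℤ f (tabulate g) ≡ f (g j)
sumℤ-tabulate-single f g zero vanish =
  trans (cong (_+_ (f (g zero)))
               (sumℤ-tabulate-zero f (λ i → g (suc i)) (λ i → vanish (suc i) (λ ()))))
        (ℤ.+-identityʳ (f (g zero)))
sumℤ-tabulate-single f g (suc j) vanish =
  trans (cong (_+ sumℤ f (tabulate (λ i → g (suc i)))) (vanish zero (λ ())))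
  (trans (ℤ.+-identityˡ _)
         (sumℤ-tabulate-single f (λ i → g (suc i)) j
            (λ i i≢j → vanish (suc i) (λ eq → i≢j (suc-injective eq)))))

count-as-sumℤ : ∀ (p : X → Bool) xs → + count p xs ≡ sumℤ (λ x → χ (p x)) xs
count-as-sumℤ p [] = refl
count-as-sumℤ p (x ∷ xs) =
  trans (ℤ.pos-+ (if p x then 1 else 0) (count p xs)) (cong (_+_ (χ (p x))) (count-as-sumℤ p xs))

sumL-as-sumℤ : ∀ (f : X → ℕ) xs → + sumL f xs ≡ sumℤ (λ x → + f x) xs
sumL-as-sumℤ f [] = refl
sumL-as-sumℤ f (x ∷ xs) = trans (ℤ.pos-+ (f x) (sumL f xs)) (cong (_+_ (+ f x)) (sumL-as-sumℤ f xs))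

eqF-sound : {u v : Fin n} → eqF u v ≡ true → u ≡ v
eqF-sound {u = u} {v} h with u ≟ v
... | yes u≡v = u≡v

eqF-refl : (v : Fin n) → eqF v v ≡ true
eqF-refl v with v ≟ v
... | yes _ = refl
... | no v≢v = ⊥-elim (v≢v refl)

eqF-≢ : {u v : Fin n} → u ≢ v → eqF u v ≡ false
eqF-≢ {u = u} {v} u≢v with u ≟ v
... | yes u≡v = ⊥-elim (u≢v u≡v)
... | no _ = refl

signedIncidence : (X → Fin n × Fin n) → (X → Bool) → X → Fin n → ℤ
signedIncidence ends D x v = χ (eqF (tailV ends D x) v) - χ (eqF (headV ends D x) v)

χ-twice-minus-∨ : ∀ a b → (a ≡ true → b ≡ true → ⊥) → + 2 * χ a - χ (a ∨ b) ≡ χ a - χ b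
χ-twice-minus-∨ true true ¬both = ⊥-elim (¬both refl refl)
χ-twice-minus-∨ true false ¬both = refl
χ-twice-minus-∨ false true ¬both = refl
χ-twice-minus-∨ false false ¬both = refl

twice-tail-minus-incident :
  ∀ (ends : X → Fin n × Fin n) D x v → proj₁ (ends x) ≢ proj₂ (ends x) →
  + 2 * χ (eqF (tailV ends D x) v) - χ (incB ends x v) ≡ signedIncidence ends D x v
twice-tail-minus-incident ends D x v loopless with D x
... | true = χ-twice-minus-∨ (eqF (proj₁ (ends x)) v) (eqF (proj₂ (ends x)) v) ¬both
  where
  ¬both : eqF (proj₁ (ends x)) v ≡ true → eqF (proj₂ (ends x)) v ≡ true → ⊥
  ¬both h₁ h₂ = loopless (trans (eqF-sound h₁) (sym (eqF-sound h₂)))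
... | false
  rewrite ∨-comm (eqF (proj₁ (ends x)) v) (eqF (proj₂ (ends x)) v) =
  χ-twice-minus-∨ (eqF (proj₂ (ends x)) v) (eqF (proj₁ (ends x)) v) ¬both
  where
  ¬both : eqF (proj₂ (ends x)) v ≡ true → eqF (proj₁ (ends x)) v ≡ true → ⊥
  ¬both h₂ h₁ = loopless (trans (eqF-sound h₁) (sym (eqF-sound h₂)))

twice-outdegree-minus-degree :
  ∀ xs (ends : X → Fin n × Fin n) D v → (∀ x → proj₁ (ends x) ≢ proj₂ (ends x)) →
  + (2 ℕ.* count (λ x → eqF (tailV ends D x) v) xs) - + count (λ x → incB ends x v) xs
    ≡ sumℤ (λ x → signedIncidence ends D x v) xs
twice-outdegree-minus-degree {X = X} xs ends D v loopless = begin
    + (2 ℕ.* count tail? xs) - + count incident? xs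
  ≡⟨ cong (_- + count incident? xs) (ℤ.pos-* 2 (count tail? xs)) ⟩
    + 2 * + count tail? xs - + count incident? xs
  ≡⟨ cong₂ (λ a b → + 2 * a - b) (count-as-sumℤ tail? xs) (count-as-sumℤ incident? xs) ⟩
    + 2 * sumℤ (λ x → χ (tail? x)) xs - sumℤ (λ x → χ (incident? x)) xs
  ≡⟨ cong (_- sumℤ (λ x → χ (incident? x)) xs) (sym (sumℤ-*ˡ (+ 2) _ xs)) ⟩
    sumℤ (λ x → + 2 * χ (tail? x)) xs - sumℤ (λ x → χ (incident? x)) xs
  ≡⟨ sym (sumℤ-- _ _ xs) ⟩
    sumℤ (λ x → + 2 * χ (tail? x) - χ (incident? x)) xs
  ≡⟨ sumℤ-cong xs (λ x → twice-tail-minus-incident ends D x v (loopless x)) ⟩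
    sumℤ (λ x → signedIncidence ends D x v) xs ∎
  where
  open ≡-Reasoning
  tail? incident? : X → Bool
  tail? x = eqF (tailV ends D x) v
  incident? x = incB ends x v

χ-scaled : ∀ a b k → + (if a then k else 0) - + (if b then k else 0) ≡ + k * (χ a - χ b)
χ-scaled true true k = identity (+ k)
  where
  identity : ∀ a → a - a ≡ a * (+ 1 - + 1)
  identity = solve-∀
χ-scaled true false k = identity (+ k)
  where
  identity : ∀ a → a - + 0 ≡ a * (+ 1 - + 0)
  identity = solve-∀
χ-scaled false true k = identity (+ k)
  where
  identity : ∀ a → + 0 - a ≡ a * (+ 0 - + 1)
  identity = solve-∀
χ-scaled false false k = sym (ℤ.*-zeroʳ (+ k))

flow-conservation :
  ∀ xs (ends : X → Fin n × Fin n) (Φ : Flow X) → IsFlow xs ends Φ → ∀ v →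
  sumℤ (λ x → + val Φ x * signedIncidence ends (dir Φ) x v) xs ≡ + 0
flow-conservation {X = X} xs ends Φ conserved v = begin
    sumℤ (λ x → + val Φ x * signedIncidence ends (dir Φ) x v) xs
  ≡⟨ sym (sumℤ-cong xs (λ x → χ-scaled (tail? x) (head? x) (val Φ x))) ⟩
    sumℤ (λ x → + out x - + in′ x) xs
  ≡⟨ sumℤ-- _ _ xs ⟩
    sumℤ (λ x → + out x) xs - sumℤ (λ x → + in′ x) xs
  ≡⟨ sym (cong₂ _-_ (sumL-as-sumℤ out xs) (sumL-as-sumℤ in′ xs)) ⟩
    + outflow xs ends Φ v - + inflow xs ends Φ v
  ≡⟨ cong (λ a → + outflow xs ends Φ v - + a) (conserved v) ⟩
    + outflow xs ends Φ v - + outflow xs ends Φ v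
  ≡⟨ ℤ.+-inverseʳ (+ outflow xs ends Φ v) ⟩
    + 0 ∎
  where
  open ≡-Reasoning
  tail? head? : X → Bool
  tail? x = eqF (tailV ends (dir Φ) x) v
  head? x = eqF (headV ends (dir Φ) x) v
  out in′ : X → ℕ
  out x = if tail? x then val Φ x else 0
  in′ x = if head? x then val Φ x else 0

signedIncidence-swap-ends :
  ∀ (ends : X → Fin n × Fin n) D x → proj₁ (ends x) ≢ proj₂ (ends x) →
  signedIncidence ends D x (proj₂ (ends x)) ≡ - signedIncidence ends D x (proj₁ (ends x))
signedIncidence-swap-ends ends D x loopless with D x
... | true rewrite eqF-refl (proj₁ (ends x)) | eqF-refl (proj₂ (ends x))
                 | eqF-≢ loopless | eqF-≢ (λ eq → loopless (sym eq)) = refl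
... | false rewrite eqF-refl (proj₁ (ends x)) | eqF-refl (proj₂ (ends x))
                  | eqF-≢ loopless | eqF-≢ (λ eq → loopless (sym eq)) = refl

signedIncidence-cong :
  ∀ (ends : X → Fin n × Fin n) D D′ x v → D x ≡ D′ x →
  signedIncidence ends D x v ≡ signedIncidence ends D′ x v
signedIncidence-cong ends D D′ x v Dx≡D′x rewrite Dx≡D′x = refl

signedIncidence-off :
  ∀ (ends : X → Fin n × Fin n) D x v → incB ends x v ≡ false → signedIncidence ends D x v ≡ + 0
signedIncidence-off ends D x v not-incident
  with eqF (proj₁ (ends x)) v in h₁ | eqF (proj₂ (ends x)) v in h₂ | not-incident
... | false | false | _ with D x
...   | true rewrite h₁ | h₂ = refl
...   | false rewrite h₁ | h₂ = refl

⊕-dir-≥ : ∀ (Φ₁ Φ₂ : Flow X) x → val Φ₂ x ℕ.≤ val Φ₁ x → dir (Φ₁ ⊕ Φ₂) x ≡ dir Φ₁ x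
⊕-dir-≥ Φ₁ Φ₂ x v₂≤v₁ with val Φ₂ x ℕ.≤ᵇ val Φ₁ x | ℕ.≤⇒≤ᵇ v₂≤v₁
... | true | _ = refl

⊕-dir-< : ∀ (Φ₁ Φ₂ : Flow X) x → val Φ₁ x ℕ.< val Φ₂ x → dir (Φ₁ ⊕ Φ₂) x ≡ dir Φ₂ x
⊕-dir-< Φ₁ Φ₂ x v₁<v₂ with val Φ₂ x ℕ.≤ᵇ val Φ₁ x in v₂≤ᵇv₁
... | false = refl
... | true = ⊥-elim (ℕ.<⇒≱ v₁<v₂ (ℕ.≤ᵇ⇒≤ _ _ (subst T (sym v₂≤ᵇv₁) tt)))

⊕-val-zeroˡ : ∀ (Φ₁ Φ₂ : Flow X) x → val Φ₁ x ≡ 0 → val (Φ₁ ⊕ Φ₂) x ≡ val Φ₂ x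
⊕-val-zeroˡ Φ₁ Φ₂ x v₁≡0 rewrite v₁≡0 with sameB (dir Φ₁ x) (dir Φ₂ x)
... | true = refl
... | false = refl

sumℤ-allMEdges-single : ∀ {m t} (f : MEdge m t → ℤ) (e : Fin m) →
                        (∀ x → x ≢ old e → f x ≡ + 0) → sumℤ f (allMEdges m t) ≡ f (old e)
sumℤ-allMEdges-single {m = m} {t} f e vanish = begin
    sumℤ f (map old (allFin m) ++ (map fe (allFin t) ++ map fe' (allFin t)))
  ≡⟨ sumℤ-++ f (map old (allFin m)) _ ⟩
    sumℤ f (map old (allFin m)) + sumℤ f (map fe (allFin t) ++ map fe' (allFin t))
  ≡⟨ cong (_+_ (sumℤ f (map old (allFin m)))) (sumℤ-++ f (map fe (allFin t)) _) ⟩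
    sumℤ f (map old (allFin m)) + (sumℤ f (map fe (allFin t)) + sumℤ f (map fe' (allFin t)))
  ≡⟨ cong₂ (λ a b → a + (sumℤ f (map fe (allFin t)) + b))
           (sumℤ-map f old (allFin m)) (sumℤ-map f fe' (allFin t)) ⟩
    sumℤ (λ i → f (old i)) (allFin m)
      + (sumℤ f (map fe (allFin t)) + sumℤ (λ i → f (fe' i)) (allFin t))
  ≡⟨ cong₂ (λ a b → a + (b + sumℤ (λ i → f (fe' i)) (allFin t)))
           (sumℤ-tabulate-single (λ i → f (old i)) (λ i → i) e
              (λ i i≢e → vanish (old i) (λ { refl → i≢e refl })))
           (sumℤ-map f fe (allFin t)) ⟩
    f (old e) + (sumℤ (λ i → f (fe i)) (allFin t) + sumℤ (λ i → f (fe' i)) (allFin t))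
  ≡⟨ cong₂ (λ a b → f (old e) + (a + b))
           (sumℤ-tabulate-zero (λ i → f (fe i)) (λ i → i) (λ i → vanish (fe i) (λ ())))
           (sumℤ-tabulate-zero (λ i → f (fe' i)) (λ i → i) (λ i → vanish (fe' i) (λ ()))) ⟩
    f (old e) + + 0
  ≡⟨ ℤ.+-identityʳ (f (old e)) ⟩
    f (old e) ∎
  where open ≡-Reasoning

w'-negated⇒InA⇔InB : ∀ {a b : ℤ} → a ≡ - b → b ≡ - (+ 2) ⇔ a ≡ + 2
w'-negated⇒InA⇔InB {a} {b} a≡-b = mk⇔ (λ b≡-2 → trans a≡-b (cong -_ b≡-2)) from
  where
  from : a ≡ + 2 → b ≡ - (+ 2)
  from a≡2 = trans (sym (ℤ.neg-involutive b)) (cong -_ (trans (sym a≡-b) a≡2))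

module FlowPartition
  {n m t k : ℕ} (ends : Fin m → Fin n × Fin n) (loopless : Loopless ends)
  (F : Fin m → Bool) (cyc : Fin n → Fin k) (c : Fin m → ℕ) (canonical : Canonical ends F cyc c)
  (z : Fin t → Bool → Fin n) (pairing : MissingPairing ends c z)
  (ΦF Φ12 Φ2 : Flow (MEdge m t))
  (isFlowF : FlowF ends z F ΦF) (isFlow12 : Flow12 ends z c Φ12)
  (isFlow2cyc : Flow2cyc ends z Φ12 Φ2)
  where

  open Canonical canonical
  open MissingPairing pairing

  E : MEdge m t → Fin n × Fin n
  E = mEnds ends z

  L : List (MEdge m t)
  L = allMEdges m t

  D : MEdge m t → Bool
  D = dir ((ΦF ⊕ Φ12) ⊕ Φ2)

  mEnds-loopless : ∀ x → proj₁ (E x) ≢ proj₂ (E x)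
  mEnds-loopless (old e) = loopless e
  mEnds-loopless (fe i) eq with inj i false i true eq
  ... | _ , ()
  mEnds-loopless (fe' i) eq with inj i false i true eq
  ... | _ , ()

  net : Flow (MEdge m t) → MEdge m t → Fin n → ℤ
  net Φ = signedIncidence E (dir Φ)

  inF : MEdge m t → Bool
  inF (old e) = F e
  inF (fe i) = false
  inF (fe' i) = false

  colourFlux : ℕ → Fin n → ℤ
  colourFlux j v = sumℤ (λ x → χ (mColour c x ≡ᵇ j) * net Φ12 x v) L

  valF : ∀ x → val ΦF x ≡ (if inF x then 2 else 0)
  valF (old e) = proj₁ (proj₂ isFlowF) e
  valF (fe i) = proj₁ (proj₂ (proj₂ isFlowF)) i
  valF (fe' i) = proj₂ (proj₂ (proj₂ isFlowF)) i

  val12 : ∀ x → val Φ12 x ≡ (if (mColour c x ≡ᵇ 1) ∨ (mColour c x ≡ᵇ 2) then 1 else 0)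
  val12 = proj₂ isFlow12

  val2-old : ∀ e → val Φ2 (old e) ≡ 0
  val2-old = proj₁ (proj₂ isFlow2cyc)

  val2-fe : ∀ i → val Φ2 (fe i) ≡ 1
  val2-fe = proj₁ (proj₂ (proj₂ isFlow2cyc))

  val2-fe' : ∀ i → val Φ2 (fe' i) ≡ 1
  val2-fe' = proj₁ (proj₂ (proj₂ (proj₂ isFlow2cyc)))

  dir2-fe' : ∀ i → dir Φ2 (fe' i) ≡ dir Φ12 (fe' i)
  dir2-fe' = proj₂ (proj₂ (proj₂ (proj₂ isFlow2cyc)))

  colour-on-F : ∀ e → F e ≡ true → (c e ≡ᵇ 1) ≡ false
  colour-on-F e e∈F with onF e e∈F
  ... | inj₁ c≡0 rewrite c≡0 = refl
  ... | inj₂ (inj₁ c≡2) rewrite c≡2 = refl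
  ... | inj₂ (inj₂ c≡3) rewrite c≡3 = refl

  D-old-in-F : ∀ e → F e ≡ true → D (old e) ≡ dir ΦF (old e)
  D-old-in-F e e∈F = begin
      D (old e)
    ≡⟨ ⊕-dir-≥ (ΦF ⊕ Φ12) Φ2 (old e) (subst (ℕ._≤ _) (sym (val2-old e)) z≤n) ⟩
      dir (ΦF ⊕ Φ12) (old e)
    ≡⟨ ⊕-dir-≥ ΦF Φ12 (old e) val12≤valF ⟩
      dir ΦF (old e) ∎
    where
    open ≡-Reasoning
    val12≤valF : val Φ12 (old e) ℕ.≤ val ΦF (old e)
    val12≤valF rewrite val12 (old e) | valF (old e) | e∈F
      with (c e ≡ᵇ 1) ∨ (c e ≡ᵇ 2)
    ... | true = s≤s z≤n
    ... | false = z≤n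

  D-old-off-F : ∀ e → F e ≡ false → D (old e) ≡ dir Φ12 (old e)
  D-old-off-F e e∉F = begin
      D (old e)
    ≡⟨ ⊕-dir-≥ (ΦF ⊕ Φ12) Φ2 (old e) (subst (ℕ._≤ _) (sym (val2-old e)) z≤n) ⟩
      dir (ΦF ⊕ Φ12) (old e)
    ≡⟨ ⊕-dir-< ΦF Φ12 (old e) valF<val12 ⟩
      dir Φ12 (old e) ∎
    where
    open ≡-Reasoning
    valF<val12 : val ΦF (old e) ℕ.< val Φ12 (old e)
    valF<val12 rewrite val12 (old e) | valF (old e) | e∉F | offF e e∉F = s≤s z≤n

  D-fe : ∀ i → D (fe i) ≡ dir Φ2 (fe i)
  D-fe i = ⊕-dir-< (ΦF ⊕ Φ12) Φ2 (fe i) val<1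
    where
    val<1 : val (ΦF ⊕ Φ12) (fe i) ℕ.< val Φ2 (fe i)
    val<1 rewrite ⊕-val-zeroˡ ΦF Φ12 (fe i) (valF (fe i)) | val12 (fe i) | val2-fe i = s≤s z≤n

  D-fe' : ∀ i → D (fe' i) ≡ dir Φ12 (fe' i)
  D-fe' i = trans (⊕-dir-≥ (ΦF ⊕ Φ12) Φ2 (fe' i) 1≤val) (⊕-dir-< ΦF Φ12 (fe' i) 0<1)
    where
    1≤val : val Φ2 (fe' i) ℕ.≤ val (ΦF ⊕ Φ12) (fe' i)
    1≤val rewrite ⊕-val-zeroˡ ΦF Φ12 (fe' i) (valF (fe' i)) | val12 (fe' i) | val2-fe' i = s≤s z≤n
    0<1 : val ΦF (fe' i) ℕ.< val Φ12 (fe' i)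
    0<1 rewrite valF (fe' i) | val12 (fe' i) = s≤s z≤n

  only-first : ∀ a b c → a ≡ + 1 * a + + 0 * b + + 0 * c
  only-first = solve-∀

  only-second : ∀ a b c → b ≡ + 0 * a + + 1 * b + + 0 * c
  only-second = solve-∀

  only-third : ∀ a b c → c ≡ + 0 * a + + 0 * b + + 1 * c
  only-third = solve-∀

  incidence-split : ∀ x v →
    signedIncidence E D x v
      ≡ χ (inF x) * net ΦF x v + χ (mColour c x ≡ᵇ 1) * net Φ12 x v + + val Φ2 x * net Φ2 x v
  incidence-split (old e) v with F e in e∈F
  ... | true =
    trans (signedIncidence-cong E D (dir ΦF) (old e) v (D-old-in-F e e∈F))
          (trans (only-first a b c′)
                 (sym (cong₂ (λ q r → χ true * a + χ q * b + + r * c′)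
                             (colour-on-F e e∈F) (val2-old e))))
    where
    a = net ΦF (old e) v
    b = net Φ12 (old e) v
    c′ = net Φ2 (old e) v
  ... | false =
    trans (signedIncidence-cong E D (dir Φ12) (old e) v (D-old-off-F e e∈F))
          (trans (only-second a b c′)
                 (sym (cong₂ (λ q r → χ false * a + χ q * b + + r * c′)
                             (cong (_≡ᵇ 1) (offF e e∈F)) (val2-old e))))
    where
    a = net ΦF (old e) v
    b = net Φ12 (old e) v
    c′ = net Φ2 (old e) v
  incidence-split (fe i) v =
    trans (signedIncidence-cong E D (dir Φ2) (fe i) v (D-fe i))
          (trans (only-third a b c′)
                 (sym (cong (λ r → χ false * a + χ false * b + + r * c′) (val2-fe i))))
    where
    a = net ΦF (fe i) v
    b = net Φ12 (fe i) v
    c′ = net Φ2 (fe i) v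
  incidence-split (fe' i) v =
    trans (signedIncidence-cong E D (dir Φ2) (fe' i) v (trans (D-fe' i) (sym (dir2-fe' i))))
          (trans (only-third a b c′)
                 (sym (cong (λ r → χ false * a + χ false * b + + r * c′) (val2-fe' i))))
    where
    a = net ΦF (fe' i) v
    b = net Φ12 (fe' i) v
    c′ = net Φ2 (fe' i) v

  net-flux-F : ∀ v → sumℤ (λ x → χ (inF x) * net ΦF x v) L ≡ + 0
  net-flux-F v = ℤ.*-cancelˡ-≡ (+ 2) _ (+ 0) (begin
      + 2 * sumℤ (λ x → χ (inF x) * net ΦF x v) L
    ≡⟨ sym (sumℤ-*ˡ (+ 2) _ L) ⟩
      sumℤ (λ x → + 2 * (χ (inF x) * net ΦF x v)) L
    ≡⟨ sumℤ-cong L (λ x → sym (half-value x)) ⟩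
      sumℤ (λ x → + val ΦF x * net ΦF x v) L
    ≡⟨ flow-conservation L E ΦF (proj₁ isFlowF) v ⟩
      + 0 ∎)
    where
    open ≡-Reasoning
    half-value : ∀ x → + val ΦF x * net ΦF x v ≡ + 2 * (χ (inF x) * net ΦF x v)
    half-value x rewrite valF x with inF x
    ... | true = cong (+ 2 *_) (sym (ℤ.*-identityˡ (net ΦF x v)))
    ... | false = trans (ℤ.*-zeroˡ (net ΦF x v))
                        (sym (trans (cong (+ 2 *_) (ℤ.*-zeroˡ (net ΦF x v))) (ℤ.*-zeroʳ (+ 2))))

  colourFlux-1+2 : ∀ v → colourFlux 1 v + colourFlux 2 v ≡ + 0
  colourFlux-1+2 v = begin
      colourFlux 1 v + colourFlux 2 v
    ≡⟨ sym (sumℤ-+ _ _ L) ⟩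
      sumℤ (λ x → χ (mColour c x ≡ᵇ 1) * net Φ12 x v + χ (mColour c x ≡ᵇ 2) * net Φ12 x v) L
    ≡⟨ sumℤ-cong L (λ x → sym (trans (cong (λ a → + a * net Φ12 x v) (val12 x))
                                     (split (mColour c x) (net Φ12 x v)))) ⟩
      sumℤ (λ x → + val Φ12 x * net Φ12 x v) L
    ≡⟨ flow-conservation L E Φ12 (proj₁ isFlow12) v ⟩
      + 0 ∎
    where
    open ≡-Reasoning
    χ-1∨2 : ∀ j → χ ((j ≡ᵇ 1) ∨ (j ≡ᵇ 2)) ≡ χ (j ≡ᵇ 1) + χ (j ≡ᵇ 2)
    χ-1∨2 0 = refl
    χ-1∨2 1 = refl
    χ-1∨2 2 = refl
    χ-1∨2 (suc (suc (suc j))) = refl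
    split : ∀ j s → χ ((j ≡ᵇ 1) ∨ (j ≡ᵇ 2)) * s ≡ χ (j ≡ᵇ 1) * s + χ (j ≡ᵇ 2) * s
    split j s = trans (cong (_* s) (χ-1∨2 j)) (ℤ.*-distribʳ-+ s (χ (j ≡ᵇ 1)) (χ (j ≡ᵇ 2)))

  half-w' : Fin n → ℤ
  half-w' v = sumℤ (λ x → signedIncidence E D x v) L

  w'≡2*half-w' : ∀ v → w' ends z D v ≡ + 2 * half-w' v
  w'≡2*half-w' v = cong (+ 2 *_) (twice-outdegree-minus-degree L E D v mEnds-loopless)

  half-w'≡colourFlux1 : ∀ v → half-w' v ≡ colourFlux 1 v
  half-w'≡colourFlux1 v = begin
      half-w' v
    ≡⟨ sumℤ-cong L (λ x → incidence-split x v) ⟩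
      sumℤ (λ x → fTerm x + oneTerm x + twoCycTerm x) L
    ≡⟨ sumℤ-+ _ twoCycTerm L ⟩
      sumℤ (λ x → fTerm x + oneTerm x) L + sumℤ twoCycTerm L
    ≡⟨ cong₂ _+_ (sumℤ-+ fTerm oneTerm L) (flow-conservation L E Φ2 (proj₁ isFlow2cyc) v) ⟩
      sumℤ fTerm L + colourFlux 1 v + + 0
    ≡⟨ cong (λ a → a + colourFlux 1 v + + 0) (net-flux-F v) ⟩
      + 0 + colourFlux 1 v + + 0
    ≡⟨ ℤ.+-identityʳ (+ 0 + colourFlux 1 v) ⟩
      + 0 + colourFlux 1 v
    ≡⟨ ℤ.+-identityˡ (colourFlux 1 v) ⟩
      colourFlux 1 v ∎
    where
    open ≡-Reasoning
    fTerm oneTerm twoCycTerm : MEdge m t → ℤ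
    fTerm x = χ (inF x) * net ΦF x v
    oneTerm x = χ (mColour c x ≡ᵇ 1) * net Φ12 x v
    twoCycTerm x = + val Φ2 x * net Φ2 x v

  half-w'≡-colourFlux2 : ∀ v → half-w' v ≡ - colourFlux 2 v
  half-w'≡-colourFlux2 v =
    trans (half-w'≡colourFlux1 v) (inverseˡ-unique (colourFlux 1 v) (colourFlux 2 v) (colourFlux-1+2 v))

  colour-unique-at : ∀ e j v x → c e ≡ j → j ≡ 1 ⊎ j ≡ 2 → incB ends e v ≡ true →
                     x ≢ old e → incB E x v ≡ true → mColour c x ≢ j
  colour-unique-at e j v (old e′) c≡j j12 e∋v x≢e e′∋v =
    λ c′≡j → proper e′ e v (λ { refl → x≢e refl }) e′∋v e∋v (trans c′≡j (sym c≡j))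
  colour-unique-at e j v (fe i) c≡j (inj₁ refl) e∋v x≢e fe∋v ()
  colour-unique-at e j v (fe i) c≡j (inj₂ refl) e∋v x≢e fe∋v ()
  colour-unique-at e j v (fe' i) c≡j (inj₁ refl) e∋v x≢e fe'∋v ()
  colour-unique-at e j v (fe' i) c≡j (inj₂ refl) e∋v x≢e fe'∋v _
    with eqF (z i false) v in z₁≡v | eqF (z i true) v in z₂≡v
  ... | true | _ =
    sound i false e (subst (λ u → incB ends e u ≡ true) (sym (eqF-sound z₁≡v)) e∋v) c≡j
  ... | false | true =
    sound i true e (subst (λ u → incB ends e u ≡ true) (sym (eqF-sound z₂≡v)) e∋v) c≡j

  colourFlux-at-end : ∀ e j v → c e ≡ j → j ≡ 1 ⊎ j ≡ 2 → incB ends e v ≡ true →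
                      colourFlux j v ≡ net Φ12 (old e) v
  colourFlux-at-end e j v c≡j j12 e∋v =
    trans (sumℤ-allMEdges-single _ e vanish) (trans (cong (_* net Φ12 (old e) v) χ≡1)
                                                    (ℤ.*-identityˡ (net Φ12 (old e) v)))
    where
    χ≡1 : χ (c e ≡ᵇ j) ≡ + 1
    χ≡1 = trans (cong (λ a → χ (a ≡ᵇ j)) c≡j) (χ-≡ᵇ-refl j)
    vanish : ∀ x → x ≢ old e → χ (mColour c x ≡ᵇ j) * net Φ12 x v ≡ + 0
    vanish x x≢e with incB E x v in x∋v
    ... | false = trans (cong (χ (mColour c x ≡ᵇ j) *_) (signedIncidence-off E (dir Φ12) x v x∋v))
                        (ℤ.*-zeroʳ (χ (mColour c x ≡ᵇ j)))
    ... | true with mColour c x ≡ᵇ j in col≡ᵇj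
    ...   | false = ℤ.*-zeroˡ (net Φ12 x v)
    ...   | true = ⊥-elim (colour-unique-at e j v x c≡j j12 e∋v x≢e x∋v
                            (ℕ.≡ᵇ⇒≡ _ _ (subst T (sym col≡ᵇj) tt)))

  ends-incident₁ : ∀ e → incB ends e (proj₁ (ends e)) ≡ true
  ends-incident₁ e rewrite eqF-refl (proj₁ (ends e)) = refl

  ends-incident₂ : ∀ e → incB ends e (proj₂ (ends e)) ≡ true
  ends-incident₂ e rewrite eqF-refl (proj₂ (ends e)) = ∨-comm _ true

  half-w'-flips : ∀ e → c e ≡ 1 ⊎ c e ≡ 2 → half-w' (proj₂ (ends e)) ≡ - half-w' (proj₁ (ends e))
  half-w'-flips e (inj₁ c≡1) = begin
      half-w' y                ≡⟨ half-w'≡colourFlux1 y ⟩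
      colourFlux 1 y           ≡⟨ colourFlux-at-end e 1 y c≡1 (inj₁ refl) (ends-incident₂ e) ⟩
      net Φ12 (old e) y        ≡⟨ signedIncidence-swap-ends E (dir Φ12) (old e) (loopless e) ⟩
      - net Φ12 (old e) x      ≡⟨ cong -_ (sym (colourFlux-at-end e 1 x c≡1 (inj₁ refl) (ends-incident₁ e))) ⟩
      - colourFlux 1 x         ≡⟨ cong -_ (sym (half-w'≡colourFlux1 x)) ⟩
      - half-w' x              ∎
    where
    open ≡-Reasoning
    x = proj₁ (ends e)
    y = proj₂ (ends e)
  half-w'-flips e (inj₂ c≡2) = begin
      half-w' y                ≡⟨ half-w'≡-colourFlux2 y ⟩
      - colourFlux 2 y         ≡⟨ cong -_ (colourFlux-at-end e 2 y c≡2 (inj₂ refl) (ends-incident₂ e)) ⟩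
      - net Φ12 (old e) y      ≡⟨ cong -_ (signedIncidence-swap-ends E (dir Φ12) (old e) (loopless e)) ⟩
      - - net Φ12 (old e) x    ≡⟨ cong (λ a → - - a) (sym (colourFlux-at-end e 2 x c≡2 (inj₂ refl) (ends-incident₁ e))) ⟩
      - - colourFlux 2 x       ≡⟨ cong -_ (sym (half-w'≡-colourFlux2 x)) ⟩
      - half-w' x              ∎
    where
    open ≡-Reasoning
    x = proj₁ (ends e)
    y = proj₂ (ends e)

  w'-flips : ∀ e → c e ≡ 1 ⊎ c e ≡ 2 → w' ends z D (proj₂ (ends e)) ≡ - w' ends z D (proj₁ (ends e))
  w'-flips e c∈12 = begin
      w' ends z D y          ≡⟨ w'≡2*half-w' y ⟩
      + 2 * half-w' y        ≡⟨ cong (+ 2 *_) (half-w'-flips e c∈12) ⟩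
      + 2 * - half-w' x      ≡⟨ sym (ℤ.neg-distribʳ-* (+ 2) (half-w' x)) ⟩
      - (+ 2 * half-w' x)    ≡⟨ cong -_ (sym (w'≡2*half-w' x)) ⟩
      - w' ends z D x        ∎
    where
    open ≡-Reasoning
    x = proj₁ (ends e)
    y = proj₂ (ends e)

lemma1 : ∀ {n m : ℕ} (ends : Fin m → Fin n × Fin n) →
         Loopless ends → Cubic ends → Bridgeless ends →
         (F : Fin m → Bool) → TwoFactor ends F →
         (k : ℕ) (cyc : Fin n → Fin k) → CycleLabelling ends F cyc →
         (c : Fin m → ℕ) → Canonical ends F cyc c →
         (t : ℕ) (z : Fin t → Bool → Fin n) → MissingPairing ends c z →
         (ΦF Φ12 Φ2 : Flow (MEdge m t)) →
         FlowF ends z F ΦF → Flow12 ends z c Φ12 → Flow2cyc ends z Φ12 Φ2 →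
         (e : Fin m) → c e ≡ 1 ⊎ c e ≡ 2 →
         InA ends z (dir ((ΦF ⊕ Φ12) ⊕ Φ2)) (proj₁ (ends e)) ⇔
         InB ends z (dir ((ΦF ⊕ Φ12) ⊕ Φ2)) (proj₂ (ends e))
lemma1 ends loopless _ _ F _ _ cyc _ c canonical _ z pairing ΦF Φ12 Φ2
       isFlowF isFlow12 isFlow2cyc e c∈12 =
  w'-negated⇒InA⇔InB
    (FlowPartition.w'-flips ends loopless F cyc c canonical z pairing ΦF Φ12 Φ2
                            isFlowF isFlow12 isFlow2cyc e c∈12)
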